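{- If $(t_k)$ and $(\tau_k)$, $k=0,1,2,\ldots$, are a binomial-transform pair of the first kind, then so are the sequences \[ a_k=-\frac{1}{k+1}\sum_{j=1}^k\tau_{j-1}\quad\text{and}\quad \alpha_k=\frac{1}{k+1}\sum_{j=1}^k t_{j-1},\qquad k=0,1,2,\ldots. \]
   Context: Two sequences $(t_k)_{k\ge0}$ and $(\tau_k)_{k\ge0}$ of complex numbers form a binomial-transform pair of the first kind if $\tau_n=\sum_{k=0}^n(-1)^k\binom nk t_k$ for every non-negative integer $n$. An empty sum equals $0$. -}

module Defs where

open import Level using (Level)
open import Data.Nat using (ℕ; zero; suc)
open import Data.Nat.Combinatorics using (_C_)
open import Algebra.Bundles using (CommutativeRing)

-- Definitions relative to a commutative ring R (the paper works in ℂ).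
module BT {c ℓ : Level} (R : CommutativeRing c ℓ) where
  open CommutativeRing R public
  open import Algebra.Definitions.RawMonoid +-rawMonoid using (_×_)

  sumTo : ℕ → (ℕ → Carrier) → Carrier
  sumTo zero    f = f 0
  sumTo (suc n) f = sumTo n f + f (suc n)

  sum1To : ℕ → (ℕ → Carrier) → Carrier
  sum1To zero    f = 0#
  sum1To (suc n) f = sum1To n f + f (suc n)

  signPow : ℕ → Carrier
  signPow zero    = 1#
  signPow (suc k) = - (signPow k)

  binom : ℕ → ℕ → Carrier
  binom n k = (n C k) × 1#

  BinomialPair₁ : (ℕ → Carrier) → (ℕ → Carrier) → Set ℓ
  BinomialPair₁ t τ = ∀ n → τ n ≈ sumTo n (λ k → signPow k * (binom n k * t k))

  IsInvSuc : (ℕ → Carrier) → Set ℓ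
  IsInvSuc inv = ∀ k → (suc k × 1#) * inv k ≈ 1#

{-# OPTIONS --safe #-}
module Submission where

-- The binomial transform T, (T x)ₙ = ∑ₖ (-1)ᵏ C(n,k) xₖ, is an involution, so t = T τ.
-- By absorption, (n+1)·C(n,k)/(k+1) = C(n+1,k+1), so (n+1)·(T a)ₙ = (T b)ₙ₊₁ where
-- b = (0, P₀, P₁, …) and Pₖ = τ₀ + … + τₖ₋₁.  Pascal's rule gives the recurrence
-- (T x)ₙ₊₁ = (T x)ₙ − (T (x ∘ suc))ₙ, whence (T P)ₙ₊₁ = −(T τ)ₙ and, by induction,
-- (T b)ₙ₊₁ = (T τ)₀ + … + (T τ)ₙ₋₁ = t₀ + … + tₙ₋₁.

open import Defs
open import Level using (Level)
open import Data.Nat using (ℕ; suc; _∸_)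
open import Algebra.Bundles using (CommutativeRing)

open import Data.Nat using (zero)
import Data.Nat as ℕ
import Data.Nat.Properties as ℕₚ
open import Data.Nat.Combinatorics using (_C_; nCk+nC[k+1]≡[n+1]C[k+1]; nC1≡n; k>n⇒nCk≡0)
open import Data.Nat.Tactic.RingSolver using (solve-∀)
open import Relation.Binary.PropositionalEquality as ≡ using (_≡_; cong; cong₂)
import Relation.Binary.Reasoning.Setoid as SetoidReasoning

module _ where
  open import Data.Nat using (_+_; _*_)
  open ℕₚ using (*-zeroʳ; *-identityˡ; *-identityʳ; *-distribˡ-+)

  [k+1]*[n+1]C[k+1]≡[n+1]*nCk : ∀ n k → suc k * (suc n C suc k) ≡ suc n * (n C k)
  [k+1]*[n+1]C[k+1]≡[n+1]*nCk zero    zero    = ≡.refl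
  [k+1]*[n+1]C[k+1]≡[n+1]*nCk zero    (suc k) = *-zeroʳ (suc (suc k))
  [k+1]*[n+1]C[k+1]≡[n+1]*nCk (suc n) zero    =
    ≡.trans (*-identityˡ _) (≡.trans (nC1≡n (suc (suc n))) (≡.sym (*-identityʳ (suc (suc n)))))
  [k+1]*[n+1]C[k+1]≡[n+1]*nCk (suc n) (suc k) = begin
    suc (suc k) * (suc (suc n) C suc (suc k))
      ≡⟨ cong (suc (suc k) *_) (≡.sym (nCk+nC[k+1]≡[n+1]C[k+1] (suc n) (suc k))) ⟩
    suc (suc k) * (a + b)
      ≡⟨ rearrange k a b ⟩
    a + (suc k * a + suc (suc k) * b)
      ≡⟨ cong (a +_) (cong₂ _+_ ([k+1]*[n+1]C[k+1]≡[n+1]*nCk n k)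
                                 ([k+1]*[n+1]C[k+1]≡[n+1]*nCk n (suc k))) ⟩
    a + (suc n * (n C k) + suc n * (n C suc k))
      ≡⟨ cong (a +_) (≡.sym (*-distribˡ-+ (suc n) (n C k) (n C suc k))) ⟩
    a + suc n * (n C k + n C suc k)
      ≡⟨ cong (λ m → a + suc n * m) (nCk+nC[k+1]≡[n+1]C[k+1] n k) ⟩
    suc (suc n) * a ∎
    where
    open ≡.≡-Reasoning
    a b : ℕ
    a = suc n C suc k
    b = suc n C suc (suc k)
    rearrange : ∀ m x y → suc (suc m) * (x + y) ≡ x + (suc m * x + suc (suc m) * y)
    rearrange = solve-∀

module BinomialTransform {c ℓ : Level} (R : CommutativeRing c ℓ) where
  open BT R
  open import Algebra.Definitions.RawMonoid +-rawMonoid using (_×_)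
  open import Algebra.Properties.Semiring.Mult semiring using (×-homo-+; ×1-homo-*)
  open import Algebra.Properties.Ring ring using (-‿distribˡ-*; -‿distribʳ-*; -‿+-comm; -‿involutive)
  open import Algebra.Properties.CommutativeSemigroup +-commutativeSemigroup using (interchange)
  open import Algebra.Properties.CommutativeSemigroup *-commutativeSemigroup using ()
    renaming (x∙yz≈y∙xz to x*yz≈y*xz)
  open SetoidReasoning setoid

  x-[x+y]≈-y : ∀ x y → x - (x + y) ≈ - y
  x-[x+y]≈-y x y = begin
    x + - (x + y)    ≈⟨ +-congˡ (-‿+-comm x y) ⟨
    x + (- x + - y)  ≈⟨ +-assoc _ _ _ ⟨
    (x - x) + - y    ≈⟨ +-congʳ (-‿inverseʳ x) ⟩
    0# + - y         ≈⟨ +-identityˡ _ ⟩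
    - y              ∎

  sumTo-cong : ∀ n {f g : ℕ → Carrier} → (∀ k → f k ≈ g k) → sumTo n f ≈ sumTo n g
  sumTo-cong zero    f≈g = f≈g 0
  sumTo-cong (suc n) f≈g = +-cong (sumTo-cong n f≈g) (f≈g (suc n))

  sumTo-distrib-+ : ∀ n (f g : ℕ → Carrier) → sumTo n (λ k → f k + g k) ≈ sumTo n f + sumTo n g
  sumTo-distrib-+ zero    f g = refl
  sumTo-distrib-+ (suc n) f g = trans (+-congʳ (sumTo-distrib-+ n f g)) (interchange _ _ _ _)

  sumTo-neg : ∀ n (f : ℕ → Carrier) → sumTo n (λ k → - f k) ≈ - sumTo n f
  sumTo-neg zero    f = refl
  sumTo-neg (suc n) f = trans (+-congʳ (sumTo-neg n f)) (-‿+-comm _ _)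

  *-distribˡ-sumTo : ∀ n a (f : ℕ → Carrier) → a * sumTo n f ≈ sumTo n (λ k → a * f k)
  *-distribˡ-sumTo zero    a f = refl
  *-distribˡ-sumTo (suc n) a f = trans (distribˡ _ _ _) (+-congʳ (*-distribˡ-sumTo n a f))

  sumTo-suc : ∀ n (f : ℕ → Carrier) → sumTo (suc n) f ≈ f 0 + sumTo n (λ k → f (suc k))
  sumTo-suc zero    f = refl
  sumTo-suc (suc n) f = trans (+-congʳ (sumTo-suc n f)) (+-assoc _ _ _)

  binom-pascal : ∀ n k → binom (suc n) (suc k) ≈ binom n k + binom n (suc k)
  binom-pascal n k = trans (reflexive (cong (_× 1#) (≡.sym (nCk+nC[k+1]≡[n+1]C[k+1] n k))))
                           (×-homo-+ 1# (n C k) (n C suc k))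

  binom-absorb : ∀ n k → (suc n × 1#) * binom n k ≈ binom (suc n) (suc k) * (suc k × 1#)
  binom-absorb n k = begin
    (suc n × 1#) * binom n k            ≈⟨ ×1-homo-* (suc n) (n C k) ⟨
    (suc n ℕ.* (n C k)) × 1#            ≡⟨ cong (_× 1#) (≡.sym ([k+1]*[n+1]C[k+1]≡[n+1]*nCk n k)) ⟩
    (suc k ℕ.* (suc n C suc k)) × 1#    ≡⟨ cong (_× 1#) (ℕₚ.*-comm (suc k) (suc n C suc k)) ⟩
    ((suc n C suc k) ℕ.* suc k) × 1#    ≈⟨ ×1-homo-* (suc n C suc k) (suc k) ⟩
    binom (suc n) (suc k) * (suc k × 1#) ∎

  binom-overflow : ∀ n → binom n (suc n) ≈ 0#
  binom-overflow n = reflexive (cong (_× 1#) (k>n⇒nCk≡0 (ℕₚ.n<1+n n)))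

  transform : (ℕ → Carrier) → ℕ → Carrier
  transform x n = sumTo n (λ k → signPow k * (binom n k * x k))

  transform-cong : ∀ {x y} → (∀ k → x k ≈ y k) → ∀ n → transform x n ≈ transform y n
  transform-cong x≈y n = sumTo-cong n (λ k → *-congˡ (*-congˡ (x≈y k)))

  transform-+ : ∀ x y n → transform (λ k → x k + y k) n ≈ transform x n + transform y n
  transform-+ x y n = trans (sumTo-cong n (λ k → trans (*-congˡ (distribˡ _ _ _)) (distribˡ _ _ _)))
                            (sumTo-distrib-+ n _ _)

  transform-neg : ∀ x n → transform (λ k → - x k) n ≈ - transform x n
  transform-neg x n = trans (sumTo-cong n (λ k →
      trans (*-congˡ (sym (-‿distribʳ-* _ _))) (sym (-‿distribʳ-* _ _))))
    (sumTo-neg n _)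

  transform-- : ∀ x y n → transform (λ k → x k - y k) n ≈ transform x n - transform y n
  transform-- x y n = trans (transform-+ x (λ k → - y k) n) (+-congˡ (transform-neg y n))

  transform-zero : ∀ x → transform x 0 ≈ x 0
  transform-zero x = trans (*-identityˡ _) (trans (*-congʳ (+-identityʳ 1#)) (*-identityˡ _))

  transform-suc : ∀ x n → transform x (suc n) ≈ transform x n - transform (λ k → x (suc k)) n
  transform-suc x n = begin
    transform x (suc n)
      ≈⟨ sumTo-suc n (term (suc n)) ⟩
    term n 0 + sumTo n (λ k → term (suc n) (suc k))
      ≈⟨ +-congˡ (sumTo-cong n pascal) ⟩
    term n 0 + sumTo n (λ k → term n (suc k) + - shiftedTerm k)
      ≈⟨ +-congˡ (trans (sumTo-distrib-+ n _ _) (+-congˡ (sumTo-neg n shiftedTerm))) ⟩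
    term n 0 + (sumTo n (λ k → term n (suc k)) - transform (λ k → x (suc k)) n)
      ≈⟨ +-assoc _ _ _ ⟨
    (term n 0 + sumTo n (λ k → term n (suc k))) - transform (λ k → x (suc k)) n
      ≈⟨ +-congʳ (sumTo-suc n (term n)) ⟨
    (transform x n + term n (suc n)) - transform (λ k → x (suc k)) n
      ≈⟨ +-congʳ (trans (+-congˡ overflow) (+-identityʳ _)) ⟩
    transform x n - transform (λ k → x (suc k)) n ∎
    where
    term : ℕ → ℕ → Carrier
    term m k = signPow k * (binom m k * x k)
    shiftedTerm : ℕ → Carrier
    shiftedTerm k = signPow k * (binom n k * x (suc k))
    pascal : ∀ k → term (suc n) (suc k) ≈ term n (suc k) + - shiftedTerm k
    pascal k = begin
      - s * (binom (suc n) (suc k) * x (suc k))           ≈⟨ *-congˡ (*-congʳ (binom-pascal n k)) ⟩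
      - s * ((p + q) * x (suc k))                         ≈⟨ -‿distribˡ-* s _ ⟨
      - (s * ((p + q) * x (suc k)))
        ≈⟨ -‿cong (*-congˡ (trans (distribʳ _ p q) (+-comm _ _))) ⟩
      - (s * (q * x (suc k) + p * x (suc k)))             ≈⟨ -‿cong (distribˡ s _ _) ⟩
      - (s * (q * x (suc k)) + s * (p * x (suc k)))       ≈⟨ -‿+-comm _ _ ⟨
      - (s * (q * x (suc k))) + - shiftedTerm k           ≈⟨ +-congʳ (-‿distribˡ-* s _) ⟩
      term n (suc k) + - shiftedTerm k                    ∎
      where
      s p q : Carrier
      s = signPow k
      p = binom n k
      q = binom n (suc k)
    overflow : term n (suc n) ≈ 0#
    overflow = trans (*-congˡ (trans (*-congʳ (binom-overflow n)) (zeroˡ _))) (zeroʳ _)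

  transform-involutive : ∀ x n → transform (transform x) n ≈ x n
  transform-involutive x zero    = trans (transform-zero (transform x)) (transform-zero x)
  transform-involutive x (suc n) = begin
    transform (transform x) (suc n)
      ≈⟨ transform-suc (transform x) n ⟩
    transform (transform x) n - transform (λ k → transform x (suc k)) n
      ≈⟨ +-congˡ (-‿cong (trans (transform-cong (λ k → transform-suc x k) n) (transform-- _ _ n))) ⟩
    transform (transform x) n - (transform (transform x) n - transform (transform x′) n)
      ≈⟨ trans (x-[x+y]≈-y _ _) (-‿involutive _) ⟩
    transform (transform x′) n
      ≈⟨ transform-involutive x′ n ⟩
    x (suc n) ∎
    where
    x′ : ℕ → Carrier
    x′ k = x (suc k)

  BinomialPair₁-sym : ∀ {t τ} → BinomialPair₁ t τ → BinomialPair₁ τ t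
  BinomialPair₁-sym {t} pair n = sym (trans (transform-cong pair n) (transform-involutive t n))

  prefixSum : (ℕ → Carrier) → ℕ → Carrier
  prefixSum x n = sum1To n (λ j → x (j ∸ 1))

  prefixSum-cong : ∀ {x y} → (∀ k → x k ≈ y k) → ∀ n → prefixSum x n ≈ prefixSum y n
  prefixSum-cong x≈y zero    = refl
  prefixSum-cong x≈y (suc n) = +-cong (prefixSum-cong x≈y n) (x≈y n)

  transform-prefixSum-suc : ∀ x n → transform (prefixSum x) (suc n) ≈ - transform x n
  transform-prefixSum-suc x n = begin
    transform (prefixSum x) (suc n)
      ≈⟨ transform-suc (prefixSum x) n ⟩
    transform (prefixSum x) n - transform (λ k → prefixSum x k + x k) n
      ≈⟨ +-congˡ (-‿cong (transform-+ (prefixSum x) x n)) ⟩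
    transform (prefixSum x) n - (transform (prefixSum x) n + transform x n)
      ≈⟨ x-[x+y]≈-y _ _ ⟩
    - transform x n ∎

  0∷_ : (ℕ → Carrier) → ℕ → Carrier
  (0∷ x) zero    = 0#
  (0∷ x) (suc k) = x k

  transform-0∷-prefixSum : ∀ x n → transform (0∷ prefixSum x) (suc n) ≈ prefixSum (transform x) n
  transform-0∷-prefixSum x zero = begin
    transform (0∷ prefixSum x) 1
      ≈⟨ transform-suc (0∷ prefixSum x) 0 ⟩
    transform (0∷ prefixSum x) 0 - transform (prefixSum x) 0
      ≈⟨ +-cong (transform-zero (0∷ prefixSum x)) (-‿cong (transform-zero (prefixSum x))) ⟩
    0# - 0#
      ≈⟨ -‿inverseʳ 0# ⟩
    0# ∎
  transform-0∷-prefixSum x (suc n) = begin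
    transform (0∷ prefixSum x) (suc (suc n))
      ≈⟨ transform-suc (0∷ prefixSum x) (suc n) ⟩
    transform (0∷ prefixSum x) (suc n) - transform (prefixSum x) (suc n)
      ≈⟨ +-cong (transform-0∷-prefixSum x n) (-‿cong (transform-prefixSum-suc x n)) ⟩
    prefixSum (transform x) n - - transform x n
      ≈⟨ +-congˡ (-‿involutive _) ⟩
    prefixSum (transform x) (suc n) ∎

  module _ {inv : ℕ → Carrier} (inv-correct : IsInvSuc inv) where

    transform-absorb : ∀ y n →
      (suc n × 1#) * transform (λ k → - (inv k * y k)) n ≈ transform (0∷ y) (suc n)
    transform-absorb y n = begin
      N * transform (λ k → - (inv k * y k)) n
        ≈⟨ *-distribˡ-sumTo n N _ ⟩
      sumTo n (λ k → N * (signPow k * (binom n k * - (inv k * y k))))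
        ≈⟨ sumTo-cong n absorb ⟩
      sumTo n (λ k → - signPow k * (binom (suc n) (suc k) * y k))
        ≈⟨ +-identityˡ _ ⟨
      0# + sumTo n (λ k → - signPow k * (binom (suc n) (suc k) * y k))
        ≈⟨ +-congʳ (trans (*-congˡ (zeroʳ _)) (zeroʳ _)) ⟨
      signPow 0 * (binom (suc n) 0 * 0#) + sumTo n (λ k → - signPow k * (binom (suc n) (suc k) * y k))
        ≈⟨ sumTo-suc n _ ⟨
      transform (0∷ y) (suc n) ∎
      where
      N : Carrier
      N = suc n × 1#
      absorb : ∀ k → N * (signPow k * (binom n k * - (inv k * y k)))
                   ≈ - signPow k * (binom (suc n) (suc k) * y k)
      absorb k = begin
        N * (s * (b * - (i * y k)))  ≈⟨ x*yz≈y*xz N s _ ⟩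
        s * (N * (b * - (i * y k)))  ≈⟨ *-congˡ (*-assoc N b _) ⟨
        s * ((N * b) * - (i * y k))  ≈⟨ *-congˡ (*-congʳ (binom-absorb n k)) ⟩
        s * ((B * K) * - (i * y k))  ≈⟨ *-congˡ (*-assoc B K _) ⟩
        s * (B * (K * - (i * y k)))  ≈⟨ *-congˡ (*-congˡ (trans (-‿cong (*-assoc K i _)) (-‿distribʳ-* K _))) ⟨
        s * (B * - ((K * i) * y k))  ≈⟨ *-congˡ (*-congˡ (-‿cong (trans (*-congʳ (inv-correct k)) (*-identityˡ _)))) ⟩
        s * (B * - y k)              ≈⟨ *-congˡ (-‿distribʳ-* B (y k)) ⟨
        s * - (B * y k)              ≈⟨ -‿distribʳ-* s _ ⟨
        - (s * (B * y k))            ≈⟨ -‿distribˡ-* s _ ⟩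
        - s * (B * y k)              ∎
        where
        s b B K i : Carrier
        s = signPow k
        b = binom n k
        B = binom (suc n) (suc k)
        K = suc k × 1#
        i = inv k

    transform-neg-inv* : ∀ y n →
      transform (λ k → - (inv k * y k)) n ≈ inv n * transform (0∷ y) (suc n)
    transform-neg-inv* y n = begin
      x                                ≈⟨ *-identityˡ x ⟨
      1# * x                           ≈⟨ *-congʳ (trans (*-comm _ _) (inv-correct n)) ⟨
      (inv n * (suc n × 1#)) * x       ≈⟨ *-assoc _ _ _ ⟩
      inv n * ((suc n × 1#) * x)       ≈⟨ *-congˡ (transform-absorb y n) ⟩
      inv n * transform (0∷ y) (suc n) ∎
      where
      x : Carrier
      x = transform (λ k → - (inv k * y k)) n

theorem18 : ∀ {c ℓ : Level} (R : CommutativeRing c ℓ) →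
    let open BT R in
    (inv : ℕ → Carrier) → IsInvSuc inv →
    (t τ : ℕ → Carrier) → BinomialPair₁ t τ →
    BinomialPair₁
      (λ k → - (inv k * sum1To k (λ j → τ (j ∸ 1))))
      (λ k → inv k * sum1To k (λ j → t (j ∸ 1)))
theorem18 R inv inv-correct t τ pair n = begin
  inv n * prefixSum t n                        ≈⟨ *-congˡ (prefixSum-cong (BinomialPair₁-sym pair) n) ⟩
  inv n * prefixSum (transform τ) n            ≈⟨ *-congˡ (transform-0∷-prefixSum τ n) ⟨
  inv n * transform (0∷ prefixSum τ) (suc n)   ≈⟨ transform-neg-inv* inv-correct (prefixSum τ) n ⟨
  transform (λ k → - (inv k * prefixSum τ k)) n ∎
  where
  open BT R
  open BinomialTransform R
  open SetoidReasoning setoid
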